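{- Let $p\neq0$ and $W_0,W_1$ be real numbers, and let $(W_j)_{j\in\mathbb Z}$ satisfy $W_j=pW_{j-1}+W_{j-2}$ for all integers $j$. Put $e_W=pW_0W_1+W_0^2-W_1^2$ and $\gamma_W=e_W(p^2-1)$. Then for every integer $k$, $$\begin{aligned} &(W_{k-1}+W_{k-3})W_{k-1}W_{k+1}W_{k+2}+W_{k-2}(W_k+W_{k-2})W_{k+1}W_{k+2}\\ &\quad+W_{k-2}W_{k-1}(W_k+W_{k+2})W_{k+2}+W_{k-2}W_{k-1}W_{k+1}(W_{k+3}+W_{k+1})\\ &=2W_k(W_{k+1}+W_{k-1})\big(2W_k^2+(-1)^k\gamma_W\big). \end{aligned}$$ -}

module Defs where

open import Level using (Level)
open import Algebra.Bundles using (CommutativeRing)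
open import Data.Nat using (ℕ; zero; suc)
open import Data.Integer using (ℤ; ∣_∣; +_) renaming (_-_ to _-ℤ_; _+_ to _+ℤ_)

module _ {c ℓ : Level} (R : CommutativeRing c ℓ) where
  open CommutativeRing R

  negOnePowℕ : ℕ → Carrier
  negOnePowℕ zero    = 1#
  negOnePowℕ (suc n) = - negOnePowℕ n

  negOnePow : ℤ → Carrier
  negOnePow k = negOnePowℕ ∣ k ∣

  Recurrence : Carrier → (ℤ → Carrier) → Set ℓ
  Recurrence p W = ∀ (j : ℤ) → W j ≈ p * W (j -ℤ + 1) + W (j -ℤ + 2)

  eW : Carrier → (ℤ → Carrier) → Carrier
  eW p W = p * W (+ 0) * W (+ 1) + W (+ 0) * W (+ 0) - W (+ 1) * W (+ 1)

  γW : Carrier → (ℤ → Carrier) → Carrier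
  γW p W = eW p W * (p * p - 1#)

-- The form p x y + x² − y², evaluated at consecutive terms (W_j, W_{j+1}), changes sign
-- at every step of the recurrence, so it equals (-1)^k e_W at j = k. After shifting the
-- sequence so that k = 0, the recurrence expresses W_{-1}, …, W_3 as polynomials in p,
-- W_{-3} and W_{-2}, and the claim becomes a polynomial identity in these three
-- variables, valid in every commutative ring and checked by ring normalisation.
module Submission where

open import Level using (Level; 0ℓ)
open import Algebra.Bundles using (CommutativeRing)
open import Algebra.Bundles.Raw using (RawRing)
import Algebra.Solver.Ring
open import Algebra.Solver.Ring.AlmostCommutativeRing
  using (fromCommutativeRing; _-Raw-AlmostCommutative⟶_)
open import Data.Integer.Base using (ℤ; +_; -[1+_]) renaming (_+_ to _+ℤ_; _-_ to _-ℤ_)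
import Data.Integer.Properties as ℤ
open import Data.Integer.Tactic.RingSolver using (solve-∀)
open import Data.Maybe.Base using (Maybe; just; nothing; From-just; from-just; map)
open import Data.Nat.Base as ℕ using (ℕ; zero; suc)
import Data.Nat.Properties as ℕ
open import Data.Product.Base using (_×_; _,_; proj₁; proj₂)
open import Data.Vec.N-ary using (N-ary; Eq; curryⁿ; curryⁿ-cong)
open import Function.Base using (_∘_)
open import Relation.Binary.PropositionalEquality as ≡ using (_≡_)
import Relation.Binary.Reasoning.Setoid
open import Relation.Nullary using (¬_; yes; no)

open import Defs

module IntegerCoefficientSolver {c ℓ : Level} (R : CommutativeRing c ℓ) where
  open CommutativeRing R
  open import Algebra.Properties.Semiring.Mult.TCOptimised semiring
    using (×-homo-+; ×1-homo-*) renaming (_×_ to _·_)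
  open import Algebra.Properties.Ring ring
    using (-‿distribˡ-*; -‿distribʳ-*; -‿involutive; -‿+-comm; ⁻¹-anti-homo‿-; -0#≈0#)
  open import Algebra.Properties.CommutativeSemigroup +-commutativeSemigroup using (interchange)
  open import Relation.Binary.Reasoning.Setoid setoid

  [a+c]-[b+d]≈[a-b]+[c-d] : ∀ a b c d → (a + c) - (b + d) ≈ (a - b) + (c - d)
  [a+c]-[b+d]≈[a-b]+[c-d] a b c d = begin
    (a + c) + - (b + d)    ≈⟨ +-congˡ (-‿+-comm b d) ⟨
    (a + c) + (- b + - d)  ≈⟨ interchange a c (- b) (- d) ⟩
    (a - b) + (c - d)      ∎

  [a-b][c-d]≈[ac+bd]-[ad+bc] : ∀ a b c d → (a - b) * (c - d) ≈ (a * c + b * d) - (a * d + b * c)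
  [a-b][c-d]≈[ac+bd]-[ad+bc] a b c d = begin
    (a + - b) * (c + - d)                      ≈⟨ distribʳ _ _ _ ⟩
    a * (c + - d) + - b * (c + - d)            ≈⟨ +-cong (distribˡ _ _ _) (distribˡ _ _ _) ⟩
    (a * c + a * - d) + (- b * c + - b * - d)
      ≈⟨ +-cong (+-congˡ (-‿distribʳ-* a d)) (+-cong (-‿distribˡ-* b c) bd≈-b*-d) ⟨
    (a * c - a * d) + (- (b * c) + b * d)      ≈⟨ +-congˡ (+-comm _ _) ⟩
    (a * c - a * d) + (b * d - b * c)          ≈⟨ interchange _ _ _ _ ⟩
    (a * c + b * d) + (- (a * d) + - (b * c))  ≈⟨ +-congˡ (-‿+-comm _ _) ⟩
    (a * c + b * d) - (a * d + b * c)          ∎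
    where
    bd≈-b*-d : b * d ≈ - b * - d
    bd≈-b*-d = begin
      b * d        ≈⟨ -‿involutive _ ⟨
      - - (b * d)  ≈⟨ -‿cong (-‿distribʳ-* b d) ⟩
      - (b * - d)  ≈⟨ -‿distribˡ-* b (- d) ⟩
      - b * - d    ∎

  a+d≈c+b⇒a-b≈c-d : ∀ {a b c d} → a + d ≈ c + b → a - b ≈ c - d
  a+d≈c+b⇒a-b≈c-d {a} {b} {c} {d} a+d≈c+b = begin
    a + - b                ≈⟨ +-identityʳ _ ⟨
    (a + - b) + 0#         ≈⟨ +-congˡ (-‿inverseʳ d) ⟨
    (a + - b) + (d + - d)  ≈⟨ interchange _ _ _ _ ⟩
    (a + d) + (- b + - d)  ≈⟨ +-cong a+d≈c+b (+-comm _ _) ⟩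
    (c + b) + (- d + - b)  ≈⟨ interchange _ _ _ _ ⟩
    (c + - d) + (b + - b)  ≈⟨ +-congˡ (-‿inverseʳ b) ⟩
    (c + - d) + 0#         ≈⟨ +-identityʳ _ ⟩
    c + - d                ∎

  -- The pair (m , n) stands for m − n.
  ℤ-asDifferences : RawRing 0ℓ 0ℓ
  ℤ-asDifferences = record
    { Carrier = ℕ × ℕ
    ; _≈_     = _≡_
    ; _+_     = λ (a , b) (c , d) → (a ℕ.+ c , b ℕ.+ d)
    ; _*_     = λ (a , b) (c , d) → (a ℕ.* c ℕ.+ b ℕ.* d , a ℕ.* d ℕ.+ b ℕ.* c)
    ; -_      = λ (a , b) → (b , a)
    ; 0#      = (0 , 0)
    ; 1#      = (1 , 0)
    }

  -- The first clause makes the constant 1# of a solved identity evaluate to 1# itself.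
  ⟦_⟧ℤ : ℕ × ℕ → Carrier
  ⟦ m , zero  ⟧ℤ = m · 1#
  ⟦ m , suc n ⟧ℤ = m · 1# - suc n · 1#

  ⟦⟧ℤ-difference : ∀ m n → ⟦ m , n ⟧ℤ ≈ m · 1# - n · 1#
  ⟦⟧ℤ-difference m zero    = begin
    m · 1#       ≈⟨ +-identityʳ _ ⟨
    m · 1# + 0#  ≈⟨ +-congˡ -0#≈0# ⟨
    m · 1# - 0#  ∎
  ⟦⟧ℤ-difference m (suc n) = refl

  homomorphism : ℤ-asDifferences -Raw-AlmostCommutative⟶ fromCommutativeRing R
  homomorphism = record
    { ⟦_⟧    = ⟦_⟧ℤ
    ; +-homo = λ (a , b) (c , d) → begin
        ⟦ a ℕ.+ c , b ℕ.+ d ⟧ℤ                  ≈⟨ ⟦⟧ℤ-difference (a ℕ.+ c) (b ℕ.+ d) ⟩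
        (a ℕ.+ c) · 1# - (b ℕ.+ d) · 1#         ≈⟨ +-cong (×-homo-+ 1# a c) (-‿cong (×-homo-+ 1# b d)) ⟩
        (a · 1# + c · 1#) - (b · 1# + d · 1#)   ≈⟨ [a+c]-[b+d]≈[a-b]+[c-d] _ _ _ _ ⟩
        (a · 1# - b · 1#) + (c · 1# - d · 1#)   ≈⟨ +-cong (⟦⟧ℤ-difference a b) (⟦⟧ℤ-difference c d) ⟨
        ⟦ a , b ⟧ℤ + ⟦ c , d ⟧ℤ                 ∎
    ; *-homo = λ (a , b) (c , d) → begin
        ⟦ a ℕ.* c ℕ.+ b ℕ.* d , a ℕ.* d ℕ.+ b ℕ.* c ⟧ℤ
          ≈⟨ ⟦⟧ℤ-difference (a ℕ.* c ℕ.+ b ℕ.* d) (a ℕ.* d ℕ.+ b ℕ.* c) ⟩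
        (a ℕ.* c ℕ.+ b ℕ.* d) · 1# - (a ℕ.* d ℕ.+ b ℕ.* c) · 1#
          ≈⟨ +-cong (embed-+* a c b d) (-‿cong (embed-+* a d b c)) ⟩
        (a · 1# * (c · 1#) + b · 1# * (d · 1#)) - (a · 1# * (d · 1#) + b · 1# * (c · 1#))
          ≈⟨ [a-b][c-d]≈[ac+bd]-[ad+bc] _ _ _ _ ⟨
        (a · 1# - b · 1#) * (c · 1# - d · 1#)   ≈⟨ *-cong (⟦⟧ℤ-difference a b) (⟦⟧ℤ-difference c d) ⟨
        ⟦ a , b ⟧ℤ * ⟦ c , d ⟧ℤ                 ∎
    ; -‿homo = λ (a , b) → begin
        ⟦ b , a ⟧ℤ             ≈⟨ ⟦⟧ℤ-difference b a ⟩
        b · 1# - a · 1#        ≈⟨ ⁻¹-anti-homo‿- _ _ ⟨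
        - (a · 1# - b · 1#)    ≈⟨ -‿cong (⟦⟧ℤ-difference a b) ⟨
        - ⟦ a , b ⟧ℤ           ∎
    ; 0-homo = refl
    ; 1-homo = refl
    }
    where
    embed-+* : ∀ a c b d → (a ℕ.* c ℕ.+ b ℕ.* d) · 1# ≈ a · 1# * (c · 1#) + b · 1# * (d · 1#)
    embed-+* a c b d = trans (×-homo-+ 1# (a ℕ.* c) (b ℕ.* d)) (+-cong (×1-homo-* a c) (×1-homo-* b d))

  _≟ℤ_ : ∀ i j → Maybe (⟦ i ⟧ℤ ≈ ⟦ j ⟧ℤ)
  (a , b) ≟ℤ (c , d) with a ℕ.+ d ℕ.≟ c ℕ.+ b
  ... | no _        = nothing
  ... | yes a+d≡c+b = just (begin
    ⟦ a , b ⟧ℤ       ≈⟨ ⟦⟧ℤ-difference a b ⟩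
    a · 1# - b · 1#  ≈⟨ a+d≈c+b⇒a-b≈c-d embedded ⟩
    c · 1# - d · 1#  ≈⟨ ⟦⟧ℤ-difference c d ⟨
    ⟦ c , d ⟧ℤ       ∎)
    where
    embedded : a · 1# + d · 1# ≈ c · 1# + b · 1#
    embedded = begin
      a · 1# + d · 1#    ≈⟨ ×-homo-+ 1# a d ⟨
      (a ℕ.+ d) · 1#     ≡⟨ ≡.cong (_· 1#) a+d≡c+b ⟩
      (c ℕ.+ b) · 1#     ≈⟨ ×-homo-+ 1# c b ⟩
      c · 1# + b · 1#    ∎

  private module RingSolver = Algebra.Solver.Ring ℤ-asDifferences (fromCommutativeRing R) homomorphism _≟ℤ_
  open RingSolver public using (Polynomial; con; var; _:+_; _:*_; _:-_; :-_; _:=_)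
  open RingSolver using (⟦_⟧; ⟦_⟧↓; normalise; _≟N_; ⟦_⟧N-cong; correct; prove)
  open import Relation.Binary.Reflection setoid var ⟦_⟧ ⟦_⟧↓ correct using (close)

  polynomialRawRing : ℕ → RawRing 0ℓ 0ℓ
  polynomialRawRing n = record
    { Carrier = Polynomial n
    ; _≈_     = _≡_
    ; _+_     = _:+_
    ; _*_     = _:*_
    ; -_      = :-_
    ; 0#      = con (0 , 0)
    ; 1#      = con (1 , 0)
    }

  prove? : ∀ {n} (e₁ e₂ : Polynomial n) → Maybe (∀ ρ → ⟦ e₁ ⟧ ρ ≈ ⟦ e₂ ⟧ ρ)
  prove? e₁ e₂ =
    map (λ nf₁≈nf₂ ρ → prove ρ e₁ e₂ (⟦ nf₁≈nf₂ ⟧N-cong ρ)) (normalise e₁ ≟N normalise e₂)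

  solve? : ∀ n (f : N-ary n (Polynomial n) (Polynomial n × Polynomial n)) →
           Maybe (Eq n _≈_ (curryⁿ ⟦ proj₁ (close n f) ⟧) (curryⁿ ⟦ proj₂ (close n f) ⟧))
  solve? n f = map (curryⁿ-cong _≈_ _ _) (prove? (proj₁ (close n f)) (proj₂ (close n f)))

  solve : ∀ n (f : N-ary n (Polynomial n) (Polynomial n × Polynomial n)) → From-just (solve? n f)
  solve n f = from-just (solve? n f)


-- Stated over raw rings so that the same expressions serve in R and as solver polynomials.
module Expressions {a b : Level} (S : RawRing a b) where
  open RawRing S

  private
    infixl 6 _-_
    _-_ : Carrier → Carrier → Carrier
    x - y = x + - y

  characteristic : (p x y : Carrier) → Carrier
  characteristic p x y = p * x * y + x * x - y * y

  fourTermSum : (w₋₃ w₋₂ w₋₁ w₀ w₁ w₂ w₃ : Carrier) → Carrier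
  fourTermSum w₋₃ w₋₂ w₋₁ w₀ w₁ w₂ w₃ =
    (w₋₁ + w₋₃) * w₋₁ * w₁ * w₂
    + w₋₂ * (w₀ + w₋₂) * w₁ * w₂
    + w₋₂ * w₋₁ * (w₀ + w₂) * w₂
    + w₋₂ * w₋₁ * w₁ * (w₃ + w₁)

  closedForm : (w₋₁ w₀ w₁ γ : Carrier) → Carrier
  closedForm w₋₁ w₀ w₁ γ = (1# + 1#) * w₀ * (w₁ + w₋₁) * ((1# + 1#) * (w₀ * w₀) + γ)

module _ {c ℓ : Level} (R : CommutativeRing c ℓ) where
  open CommutativeRing R
  open IntegerCoefficientSolver R
  open Expressions rawRing
  private module Poly = Expressions (polynomialRawRing 3)
  open import Algebra.Properties.Ring ring using (-‿distribˡ-*; -‿involutive)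
  open import Relation.Binary.Reasoning.Setoid setoid

  characteristic-cong : ∀ {p x x′ y y′} → x ≈ x′ → y ≈ y′ →
                        characteristic p x y ≈ characteristic p x′ y′
  characteristic-cong x≈x′ y≈y′ =
    +-cong (+-cong (*-cong (*-congˡ x≈x′) y≈y′) (*-cong x≈x′ x≈x′)) (-‿cong (*-cong y≈y′ y≈y′))

  fourTermSum-cong : ∀ {w₋₃ w₋₃′ w₋₂ w₋₂′ w₋₁ w₋₁′ w₀ w₀′ w₁ w₁′ w₂ w₂′ w₃ w₃′} →
    w₋₃ ≈ w₋₃′ → w₋₂ ≈ w₋₂′ → w₋₁ ≈ w₋₁′ → w₀ ≈ w₀′ → w₁ ≈ w₁′ → w₂ ≈ w₂′ → w₃ ≈ w₃′ →
    fourTermSum w₋₃ w₋₂ w₋₁ w₀ w₁ w₂ w₃ ≈ fourTermSum w₋₃′ w₋₂′ w₋₁′ w₀′ w₁′ w₂′ w₃′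
  fourTermSum-cong ≈₋₃ ≈₋₂ ≈₋₁ ≈₀ ≈₁ ≈₂ ≈₃ =
    +-cong (+-cong (+-cong
      (*-cong (*-cong (*-cong (+-cong ≈₋₁ ≈₋₃) ≈₋₁) ≈₁) ≈₂)
      (*-cong (*-cong (*-cong ≈₋₂ (+-cong ≈₀ ≈₋₂)) ≈₁) ≈₂))
      (*-cong (*-cong (*-cong ≈₋₂ ≈₋₁) (+-cong ≈₀ ≈₂)) ≈₂))
      (*-cong (*-cong (*-cong ≈₋₂ ≈₋₁) ≈₁) (+-cong ≈₃ ≈₁))

  closedForm-cong : ∀ {w₋₁ w₋₁′ w₀ w₀′ w₁ w₁′ γ γ′} →
    w₋₁ ≈ w₋₁′ → w₀ ≈ w₀′ → w₁ ≈ w₁′ → γ ≈ γ′ →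
    closedForm w₋₁ w₀ w₁ γ ≈ closedForm w₋₁′ w₀′ w₁′ γ′
  closedForm-cong ≈₋₁ ≈₀ ≈₁ γ≈γ′ =
    *-cong (*-cong (*-congˡ ≈₀) (+-cong ≈₁ ≈₋₁)) (+-cong (*-congˡ (*-cong ≈₀ ≈₀)) γ≈γ′)

  characteristic-step : ∀ p x y → characteristic p y (p * y + x) ≈ - characteristic p x y
  characteristic-step = solve 3 λ p x y →
    Poly.characteristic p y (p :* y :+ x) := :- Poly.characteristic p x y

  fourTermSum≈closedForm : ∀ p z a →
    let w₋₁ = p * a + z
        w₀  = p * w₋₁ + a
        w₁  = p * w₀ + w₋₁
        w₂  = p * w₁ + w₀
        w₃  = p * w₂ + w₁
    in fourTermSum z a w₋₁ w₀ w₁ w₂ w₃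
       ≈ closedForm w₋₁ w₀ w₁ (characteristic p w₀ w₁ * (p * p - 1#))
  fourTermSum≈closedForm = solve 3 λ p z a →
    let w₋₁ = p :* a :+ z
        w₀  = p :* w₋₁ :+ a
        w₁  = p :* w₀ :+ w₋₁
        w₂  = p :* w₁ :+ w₀
        w₃  = p :* w₂ :+ w₁
    in Poly.fourTermSum z a w₋₁ w₀ w₁ w₂ w₃
       := Poly.closedForm w₋₁ w₀ w₁ (Poly.characteristic p w₀ w₁ :* (p :* p :- con (1 , 0)))

  x≈-y⇒y≈s*e⇒x≈-s*e : ∀ {x y s e} → x ≈ - y → y ≈ s * e → x ≈ - s * e
  x≈-y⇒y≈s*e⇒x≈-s*e x≈-y y≈s*e = trans x≈-y (trans (-‿cong y≈s*e) (-‿distribˡ-* _ _))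

  module _ {p : Carrier} {W : ℤ → Carrier} (recurrence : Recurrence R p W) where

    recurrence-at : ∀ {j i₁ i₂} → j -ℤ + 1 ≡ i₁ → j -ℤ + 2 ≡ i₂ → W j ≈ p * W i₁ + W i₂
    recurrence-at {j} ≡.refl ≡.refl = recurrence j

    shift-recurrence : ∀ k → Recurrence R p (λ i → W (k +ℤ i))
    shift-recurrence k i = recurrence-at (ℤ.+-assoc k i _) (ℤ.+-assoc k i _)

    characteristicAt : ℤ → Carrier
    characteristicAt j = characteristic p (W j) (W (j +ℤ + 1))

    characteristicAt-suc : ∀ j → characteristicAt (j +ℤ + 1) ≈ - characteristicAt j
    characteristicAt-suc j = begin
      characteristic p (W (j +ℤ + 1)) (W (j +ℤ + 1 +ℤ + 1))
        ≈⟨ characteristic-cong refl (recurrence-at (index₁ j) (index₂ j)) ⟩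
      characteristic p (W (j +ℤ + 1)) (p * W (j +ℤ + 1) + W j)
        ≈⟨ characteristic-step p (W j) (W (j +ℤ + 1)) ⟩
      - characteristicAt j ∎
      where
      index₁ : ∀ j → j +ℤ + 1 +ℤ + 1 -ℤ + 1 ≡ j +ℤ + 1
      index₁ = solve-∀
      index₂ : ∀ j → j +ℤ + 1 +ℤ + 1 -ℤ + 2 ≡ j
      index₂ = solve-∀

    characteristicAt-pred : ∀ j → characteristicAt j ≈ - characteristicAt (j +ℤ + 1)
    characteristicAt-pred j = begin
      characteristicAt j              ≈⟨ -‿involutive _ ⟨
      - - characteristicAt j          ≈⟨ -‿cong (characteristicAt-suc j) ⟨
      - characteristicAt (j +ℤ + 1)   ∎

    characteristicAt≈negOnePow : ∀ k → characteristicAt k ≈ negOnePow R k * eW R p W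
    characteristicAt≈negOnePow (+ n)    = nonNegative n
      where
      nonNegative : ∀ n → characteristicAt (+ n) ≈ negOnePowℕ R n * eW R p W
      nonNegative zero    = sym (*-identityˡ _)
      nonNegative (suc n) = x≈-y⇒y≈s*e⇒x≈-s*e
        (trans (reflexive (≡.cong (characteristicAt ∘ +_) (ℕ.+-comm 1 n)))
               (characteristicAt-suc (+ n)))
        (nonNegative n)
    characteristicAt≈negOnePow -[1+ n ] = negative n
      where
      negative : ∀ n → characteristicAt -[1+ n ] ≈ negOnePowℕ R (suc n) * eW R p W
      negative zero    =
        x≈-y⇒y≈s*e⇒x≈-s*e (characteristicAt-pred -[1+ 0 ]) (characteristicAt≈negOnePow (+ 0))
      negative (suc n) =
        x≈-y⇒y≈s*e⇒x≈-s*e (characteristicAt-pred -[1+ suc n ]) (negative n)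

    fourTermSum≈closedForm-at-origin :
      fourTermSum (W -[1+ 2 ]) (W -[1+ 1 ]) (W -[1+ 0 ]) (W (+ 0)) (W (+ 1)) (W (+ 2)) (W (+ 3))
      ≈ closedForm (W -[1+ 0 ]) (W (+ 0)) (W (+ 1)) (γW R p W)
    fourTermSum≈closedForm-at-origin = begin
      fourTermSum z a (W -[1+ 0 ]) (W (+ 0)) (W (+ 1)) (W (+ 2)) (W (+ 3))
        ≈⟨ fourTermSum-cong refl refl ≈₋₁ ≈₀ ≈₁ ≈₂ ≈₃ ⟩
      fourTermSum z a w₋₁ w₀ w₁ w₂ w₃
        ≈⟨ fourTermSum≈closedForm p z a ⟩
      closedForm w₋₁ w₀ w₁ (characteristic p w₀ w₁ * (p * p - 1#))
        ≈⟨ closedForm-cong ≈₋₁ ≈₀ ≈₁ (*-congʳ (characteristic-cong ≈₀ ≈₁)) ⟨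
      closedForm (W -[1+ 0 ]) (W (+ 0)) (W (+ 1)) (γW R p W) ∎
      where
      z a w₋₁ w₀ w₁ w₂ w₃ : Carrier
      z = W -[1+ 2 ]
      a = W -[1+ 1 ]
      w₋₁ = p * a + z
      w₀  = p * w₋₁ + a
      w₁  = p * w₀ + w₋₁
      w₂  = p * w₁ + w₀
      w₃  = p * w₂ + w₁
      ≈₋₁ : W -[1+ 0 ] ≈ w₋₁
      ≈₋₁ = recurrence -[1+ 0 ]
      ≈₀ : W (+ 0) ≈ w₀
      ≈₀ = trans (recurrence (+ 0)) (+-congʳ (*-congˡ ≈₋₁))
      ≈₁ : W (+ 1) ≈ w₁
      ≈₁ = trans (recurrence (+ 1)) (+-cong (*-congˡ ≈₀) ≈₋₁)
      ≈₂ : W (+ 2) ≈ w₂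
      ≈₂ = trans (recurrence (+ 2)) (+-cong (*-congˡ ≈₁) ≈₀)
      ≈₃ : W (+ 3) ≈ w₃
      ≈₃ = trans (recurrence (+ 3)) (+-cong (*-congˡ ≈₂) ≈₁)

-- The identity is polynomial in p.
proposition8 : ∀ {c ℓ : Level} (R : CommutativeRing c ℓ) →
    let open CommutativeRing R in
    (p : Carrier) → ¬ (p ≈ 0#) → (W : ℤ → Carrier) → Recurrence R p W →
    (k : ℤ) →
      (W (k -ℤ + 1) + W (k -ℤ + 3)) * W (k -ℤ + 1) * W (k +ℤ + 1) * W (k +ℤ + 2)
      + W (k -ℤ + 2) * (W k + W (k -ℤ + 2)) * W (k +ℤ + 1) * W (k +ℤ + 2)
      + W (k -ℤ + 2) * W (k -ℤ + 1) * (W k + W (k +ℤ + 2)) * W (k +ℤ + 2)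
      + W (k -ℤ + 2) * W (k -ℤ + 1) * W (k +ℤ + 1) * (W (k +ℤ + 3) + W (k +ℤ + 1))
      ≈ (1# + 1#) * W k * (W (k +ℤ + 1) + W (k -ℤ + 1))
          * ((1# + 1#) * (W k * W k) + negOnePow R k * γW R p W)
proposition8 R p _ W recurrence k = begin
  fourTermSum (W (k -ℤ + 3)) (W (k -ℤ + 2)) (W (k -ℤ + 1)) (W k)
              (W (k +ℤ + 1)) (W (k +ℤ + 2)) (W (k +ℤ + 3))
    ≈⟨ fourTermSum-cong R refl refl refl Wk≈V₀ refl refl refl ⟩
  fourTermSum (V -[1+ 2 ]) (V -[1+ 1 ]) (V -[1+ 0 ]) (V (+ 0)) (V (+ 1)) (V (+ 2)) (V (+ 3))
    ≈⟨ fourTermSum≈closedForm-at-origin R (shift-recurrence R recurrence k) ⟩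
  closedForm (V -[1+ 0 ]) (V (+ 0)) (V (+ 1)) (γW R p V)
    ≈⟨ closedForm-cong R refl Wk≈V₀ refl γ-shift ⟨
  closedForm (W (k -ℤ + 1)) (W k) (W (k +ℤ + 1)) (negOnePow R k * γW R p W) ∎
  where
  open CommutativeRing R
  open Expressions rawRing
  open Relation.Binary.Reasoning.Setoid setoid
  -- V i agrees definitionally with W (k ± n) for n ≠ 0; only V (+ 0) differs from W k.
  V : ℤ → Carrier
  V i = W (k +ℤ i)
  Wk≈V₀ : W k ≈ V (+ 0)
  Wk≈V₀ = reflexive (≡.cong W (≡.sym (ℤ.+-identityʳ k)))
  γ-shift : negOnePow R k * γW R p W ≈ γW R p V
  γ-shift = begin
    negOnePow R k * (eW R p W * (p * p - 1#))
      ≈⟨ *-assoc _ _ _ ⟨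
    negOnePow R k * eW R p W * (p * p - 1#)
      ≈⟨ *-congʳ (characteristicAt≈negOnePow R recurrence k) ⟨
    characteristicAt R recurrence k * (p * p - 1#)
      ≈⟨ *-congʳ (characteristic-cong R Wk≈V₀ refl) ⟩
    γW R p V ∎
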